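{- Let $\mathcal{B}=\{\mathbf{f}_1,\dots,\mathbf{f}_n\}\subseteq\mathbb{Z}[t]^m$ be a parametric lattice basis sorted by degree (if $i<j$ then $\deg\mathbf{f}_i\le\deg\mathbf{f}_j$) whose set of pilot vectors $\widetilde{\mathcal{B}}$ is linearly independent. For each $d$ let $\mathcal{B}_d$ be the set of elements of $\mathcal{B}$ of degree $d$, and assume $\mathcal{B}_d\perp^{asym}\mathcal{B}_e$ whenever $d\neq e$. Then whenever $i<j$ and $\deg(\mathbf{f}_i)<\deg(\mathbf{f}_j)$, we have $\deg(\rho_{j,i})<\deg(\mathbf{f}_j)-\deg(\mathbf{f}_i)$, where $\rho_{j,i}$ are the Gram–Schmidt coefficients of $\mathcal{B}$ over $\mathbb{Q}(t)$.
   Context: A parametric lattice basis is a list $\mathbf{f}_1,\dots,\mathbf{f}_n\in\mathbb{Z}[t]^m$ such that $\mathbf{f}_1(t),\dots,\mathbf{f}_n(t)$ are linearly independent for all sufficiently large $t\in\mathbb{N}$. $\deg\mathbf{f}$ is the maximum degree of the coordinates; the pilot vector $\widetilde{\mathbf{f}}$ is the vector of coefficients of $t^{\deg\mathbf{f}}$. The degree of a nonzero rational function is the degree of the numerator minus that of the denominator ($\deg 0=-\infty$). Two parametric vectors are asymptotically orthogonal if their pilot vectors are orthogonal; for sets, $S\perp^{asym}T$ means every element of $S$ is asymptotically orthogonal to every element of $T$. Gram–Schmidt over $\mathbb{Q}(t)$: $\mathbf{f}_1^*=\mathbf{f}_1$, $\mathbf{f}_j^*=\mathbf{f}_j-\sum_{i<j}\rho_{j,i}\mathbf{f}_i^*$,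 $\rho_{j,i}=\langle\mathbf{f}_j,\mathbf{f}_i^*\rangle/\langle\mathbf{f}_i^*,\mathbf{f}_i^*\rangle$. -}

module Defs where

open import Data.Nat as ℕ using (ℕ; zero; suc; _<?_)
open import Data.Integer as ℤ using (ℤ; +_; 0ℤ; 1ℤ)
open import Data.Fin using (Fin; zero; suc; fromℕ<)
open import Data.List using (List; []; _∷_; _++_; [_]; foldr; map)
open import Data.Maybe using (Maybe; just; nothing)
open import Data.Product using (∃)
open import Data.Unit using (⊤)
open import Data.Empty using (⊥)
open import Relation.Nullary using (yes; no)
open import Relation.Binary.PropositionalEquality using (_≡_)

-- Polynomials in ℤ[t]: coefficient lists, lowest degree first
-- (trailing zeros allowed; all notions below are representation-independent)

Poly : Set
Poly = List ℤ

-- degree: nothing = the zero polynomial (degree -∞)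
degP : Poly → Maybe ℕ
degP [] = nothing
degP (a ∷ p) with degP p
... | just d = just (suc d)
... | nothing with a ℤ.≟ 0ℤ
...   | yes _ = nothing
...   | no _ = just 0

coeff : Poly → ℕ → ℤ
coeff [] k = 0ℤ
coeff (a ∷ p) zero = a
coeff (a ∷ p) (suc k) = coeff p k

evalP : Poly → ℕ → ℤ
evalP [] t = 0ℤ
evalP (a ∷ p) t = a ℤ.+ (+ t) ℤ.* evalP p t

_+P_ : Poly → Poly → Poly
[] +P q = q
(a ∷ p) +P [] = a ∷ p
(a ∷ p) +P (b ∷ q) = (a ℤ.+ b) ∷ (p +P q)

scaleP : ℤ → Poly → Poly
scaleP a p = map (a ℤ.*_) p

_*P_ : Poly → Poly → Poly
[] *P q = []
(a ∷ p) *P q = scaleP a q +P (0ℤ ∷ (p *P q))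

negP : Poly → Poly
negP = map (λ a → ℤ.- a)

-- Rational functions in ℚ(t) = Frac(ℤ[t]) as fractions num/den, den ≠ 0

record RF : Set where
  constructor _//_
  field
    num : Poly
    den : Poly
open RF public

0RF : RF
0RF = [] // (1ℤ ∷ [])

fromPoly : Poly → RF
fromPoly p = p // (1ℤ ∷ [])

_+R_ : RF → RF → RF
(a // b) +R (c // d) = ((a *P d) +P (c *P b)) // (b *P d)

_*R_ : RF → RF → RF
(a // b) *R (c // d) = (a *P c) // (b *P d)

-R_ : RF → RF
-R (a // b) = negP a // b

-- division; dividing by zero (never happens in Gram–Schmidt of a basis) gives 0
_/R_ : RF → RF → RF
(a // b) /R (c // d) with degP c
... | nothing = 0RF
... | just _ = (a *P d) // (b *P c)

-- degree of a rational function: deg num − deg den, nothing = -∞ (for 0)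
degR : RF → Maybe ℤ
degR (a // b) with degP a | degP b
... | just da | just db = just (+ da ℤ.- + db)
... | _ | _ = nothing

sumℤ : ∀ {n} → (Fin n → ℤ) → ℤ
sumℤ {zero} f = 0ℤ
sumℤ {suc n} f = f zero ℤ.+ sumℤ (λ i → f (suc i))

sumR : ∀ {n} → (Fin n → RF) → RF
sumR {zero} f = 0RF
sumR {suc n} f = f zero +R sumR (λ i → f (suc i))

-- Maybe ℕ / Maybe ℤ with nothing read as -∞

maxM : Maybe ℕ → Maybe ℕ → Maybe ℕ
maxM nothing y = y
maxM x nothing = x
maxM (just x) (just y) = just (x ℕ.⊔ y)

_≤M_ : Maybe ℕ → Maybe ℕ → Set
nothing ≤M _ = ⊤
just x ≤M nothing = ⊥
just x ≤M just y = x ℕ.≤ y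

_<M_ : Maybe ℤ → ℤ → Set
nothing <M k = ⊤
just x <M k = x ℤ.< k

PVec : ℕ → Set
PVec m = Fin m → Poly

degV : ∀ {m} → PVec m → Maybe ℕ
degV {zero} f = nothing
degV {suc m} f = maxM (degP (f zero)) (degV (λ k → f (suc k)))

pilot : ∀ {m} → PVec m → Fin m → ℤ
pilot f k with degV f
... | nothing = 0ℤ
... | just d = coeff (f k) d

evalV : ∀ {m} → PVec m → ℕ → Fin m → ℤ
evalV f t k = evalP (f k) t

dotℤ : ∀ {m} → (Fin m → ℤ) → (Fin m → ℤ) → ℤ
dotℤ u v = sumℤ (λ k → u k ℤ.* v k)

-- linear independence of n integer vectors in ℤ^m (over ℤ, equivalently over ℚ)
LinIndep : ∀ {n m} → (Fin n → Fin m → ℤ) → Set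
LinIndep {n} {m} v =
  (c : Fin n → ℤ) → (∀ k → sumℤ (λ i → c i ℤ.* v i k) ≡ 0ℤ) → ∀ i → c i ≡ 0ℤ

ParametricBasis : ∀ {n m} → (Fin n → PVec m) → Set
ParametricBasis B = ∃ λ T → ∀ t → T ℕ.≤ t → LinIndep (λ i → evalV (B i) t)

RVec : ℕ → Set
RVec m = Fin m → RF

dotR : ∀ {m} → RVec m → RVec m → RF
dotR u v = sumR (λ k → u k *R v k)

toR : ∀ {m} → PVec m → RVec m
toR f k = fromPoly (f k)

-- the basis vector with ℕ-index j (zero vector when j ≥ n; never used then)
at : ∀ {n m} → (Fin n → PVec m) → ℕ → RVec m
at {n} B j with j <? n
... | yes p = toR (B (fromℕ< p))
... | no _ = λ _ → 0RF

gsCoef : ∀ {m} → RVec m → RVec m → RF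
gsCoef f g = dotR f g /R dotR g g

reduce : ∀ {m} → RVec m → List (RVec m) → RVec m
reduce f gs k = f k +R (-R foldr (λ g acc → (gsCoef f g *R g k) +R acc) 0RF gs)

starsBefore : ∀ {n m} → (Fin n → PVec m) → ℕ → List (RVec m)
starsBefore B zero = []
starsBefore B (suc j) = starsBefore B j ++ [ reduce (at B j) (starsBefore B j) ]

gsStar : ∀ {n m} → (Fin n → PVec m) → Fin n → RVec m
gsStar B j = reduce (toR (B j)) (starsBefore B (Data.Fin.toℕ j))

gsρ : ∀ {n m} → (Fin n → PVec m) → Fin n → Fin n → RF
gsρ B j i = gsCoef (toR (B j)) (gsStar B i)

-- Write f_k = p_k t^(d_k) + (lower terms), p_k the pilot of f_k. By induction on k,
-- f*_k = L_k t^(d_k) + (lower terms) with L_k ∈ p_k + span {p_l | l < k}: the coefficient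
-- ρ_{k,l} has top term (⟨p_k, L_l⟩ / ⟨L_l, L_l⟩) t^(d_k - d_l), so subtracting ρ_{k,l} f*_l
-- only adds multiples of L_l at degree d_k. Independence of the pilots makes every L_i
-- nonzero, so ⟨f*_i, f*_i⟩ has exact degree 2 d_i. If d_i < d_j, every p_l with l ≤ i has
-- degree d_l ≤ d_i < d_j, hence is orthogonal to p_j; so ⟨p_j, L_i⟩ = 0, the coefficient of
-- t^(d_j + d_i) in ⟨f_j, f*_i⟩ vanishes, and deg ρ_{j,i} < d_j - d_i.
module Submission where

open import Defs
open import Data.Nat using (ℕ)
open import Data.Integer using (+_; _-_; 0ℤ)
open import Data.Fin using (Fin; _<_)
open import Data.Maybe using (just)
open import Relation.Binary.PropositionalEquality using (_≡_; _≢_)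

open import Data.Nat as ℕ using (zero; suc; z≤n; s≤s)
import Data.Nat.Properties as ℕP
open import Data.Nat.Tactic.RingSolver using (solve-∀)
open import Data.Integer as ℤ using (ℤ; 1ℤ)
import Data.Integer.Properties as ℤP
open import Data.Rational as ℚ using (ℚ; 0ℚ; 1ℚ)
import Data.Rational.Properties as ℚP
open import Data.Rational.Solver using (module +-*-Solver)
import Data.Rational.Unnormalised as ℚᵘ
import Data.Rational.Unnormalised.Properties as ℚᵘP
open import Data.Fin as F using (zero; suc)
import Data.Fin.Properties as FP
import Data.Fin.Induction as FI
open import Data.List using (List; []; _∷_; _++_; [_]; foldr)
open import Data.List.Relation.Unary.All using (All; []; _∷_)
open import Data.List.Relation.Unary.All.Properties using (++⁺)
open import Data.Maybe using (nothing)
open import Data.Maybe.Properties using (just-injective)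
open import Data.Product using (Σ; _×_; _,_; proj₁; proj₂)
open import Data.Sum using (_⊎_; inj₁; inj₂)
open import Data.Empty using (⊥-elim)
open import Relation.Nullary using (yes; no)
open import Relation.Binary.PropositionalEquality
  using (refl; sym; trans; cong; cong₂; subst; subst₂; module ≡-Reasoning)
open import Algebra.Bundles using (Ring)
open import Algebra.Properties.Semiring.Sum (Ring.semiring ℚP.+-*-ring)
  using (sum; sum-cong-≗; sum-replicate-zero; ∑-distrib-+; ∑-comm; *-distribˡ-sum)
import Induction.WellFounded as WF
open import Level using (0ℓ)

-- Polynomials

DegP≤ : Poly → ℕ → Set
DegP≤ p D = ∀ k → D ℕ.< k → coeff p k ≡ 0ℤ

IsZeroP : Poly → Set
IsZeroP p = ∀ k → coeff p k ≡ 0ℤ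

coeff-+P : ∀ p q k → coeff (p +P q) k ≡ coeff p k ℤ.+ coeff q k
coeff-+P []      q       k       = sym (ℤP.+-identityˡ _)
coeff-+P (a ∷ p) []      k       = sym (ℤP.+-identityʳ _)
coeff-+P (a ∷ p) (b ∷ q) zero    = refl
coeff-+P (a ∷ p) (b ∷ q) (suc k) = coeff-+P p q k

coeff-scaleP : ∀ a p k → coeff (scaleP a p) k ≡ a ℤ.* coeff p k
coeff-scaleP a []      k       = sym (ℤP.*-zeroʳ a)
coeff-scaleP a (b ∷ p) zero    = refl
coeff-scaleP a (b ∷ p) (suc k) = coeff-scaleP a p k

coeff-negP : ∀ p k → coeff (negP p) k ≡ ℤ.- coeff p k
coeff-negP []      k       = refl
coeff-negP (b ∷ p) zero    = refl
coeff-negP (b ∷ p) (suc k) = coeff-negP p k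

coeff-∷*P : ∀ a p q k → coeff ((a ∷ p) *P q) k ≡ a ℤ.* coeff q k ℤ.+ coeff (0ℤ ∷ (p *P q)) k
coeff-∷*P a p q k = trans (coeff-+P (scaleP a q) _ k) (cong (ℤ._+ _) (coeff-scaleP a q k))

isZero-*P : ∀ p q → IsZeroP p → IsZeroP (p *P q)
isZero-*P []      q p≡0 k = refl
isZero-*P (a ∷ p) q p≡0 k = trans (coeff-∷*P a p q k) (cong₂ ℤ._+_ (cong (ℤ._* _) (p≡0 0)) (shifted k))
  where
  shifted : ∀ k → coeff (0ℤ ∷ (p *P q)) k ≡ 0ℤ
  shifted zero    = refl
  shifted (suc k) = isZero-*P p q (λ k → p≡0 (suc k)) k

degP≤-zero-tail : ∀ a p → DegP≤ (a ∷ p) 0 → IsZeroP p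
degP≤-zero-tail a p bd k = bd (suc k) (s≤s z≤n)

degP≤-*P : ∀ p q {D E} → DegP≤ p D → DegP≤ q E → DegP≤ (p *P q) (D ℕ.+ E)
degP≤-*P []      q         bp bq k _ = refl
degP≤-*P (a ∷ p) q {zero}  bp bq (suc k) E<k =
  trans (coeff-∷*P a p q (suc k))
        (cong₂ ℤ._+_ (trans (cong (a ℤ.*_) (bq (suc k) E<k)) (ℤP.*-zeroʳ a))
                     (isZero-*P p q (degP≤-zero-tail a p bp) k))
degP≤-*P (a ∷ p) q {suc D} {E} bp bq (suc k) (s≤s D+E<k) =
  trans (coeff-∷*P a p q (suc k))
        (cong₂ ℤ._+_ (trans (cong (a ℤ.*_) (bq (suc k) E<1+k)) (ℤP.*-zeroʳ a))
                     (degP≤-*P p q (λ k D<k → bp (suc k) (s≤s D<k)) bq k D+E<k))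
  where
  E<1+k : E ℕ.< suc k
  E<1+k = s≤s (ℕP.≤-trans (ℕP.m≤n+m E D) (ℕP.<⇒≤ D+E<k))

coeff-*P-top : ∀ p q {D E} → DegP≤ p D → DegP≤ q E →
  coeff (p *P q) (D ℕ.+ E) ≡ coeff p D ℤ.* coeff q E
coeff-*P-top []      q {E = E} bp bq = sym (ℤP.*-zeroˡ (coeff q E))
coeff-*P-top (a ∷ p) q {zero} {E} bp bq =
  trans (coeff-∷*P a p q E) (trans (cong (ℤ._+_ (a ℤ.* coeff q E)) (shifted E)) (ℤP.+-identityʳ _))
  where
  shifted : ∀ k → coeff (0ℤ ∷ (p *P q)) k ≡ 0ℤ
  shifted zero    = refl
  shifted (suc k) = isZero-*P p q (degP≤-zero-tail a p bp) k
coeff-*P-top (a ∷ p) q {suc D} {E} bp bq =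
  trans (coeff-∷*P a p q (suc (D ℕ.+ E)))
        (trans (cong₂ ℤ._+_ (trans (cong (a ℤ.*_) (bq _ (s≤s (ℕP.m≤n+m E D)))) (ℤP.*-zeroʳ a))
                            (coeff-*P-top p q (λ k D<k → bp (suc k) (s≤s D<k)) bq))
               (ℤP.+-identityˡ _))

degP≤-+P : ∀ p q {D} → DegP≤ p D → DegP≤ q D → DegP≤ (p +P q) D
degP≤-+P p q bp bq k D<k = trans (coeff-+P p q k) (cong₂ ℤ._+_ (bp k D<k) (bq k D<k))

degP≤-negP : ∀ p {D} → DegP≤ p D → DegP≤ (negP p) D
degP≤-negP p bp k D<k = trans (coeff-negP p k) (cong ℤ.-_ (bp k D<k))

degP≤-mono : ∀ p {D D′} → D ℕ.≤ D′ → DegP≤ p D → DegP≤ p D′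
degP≤-mono p D≤D′ bp k D′<k = bp k (ℕP.≤-<-trans D≤D′ D′<k)

degP≡nothing⇒isZero : ∀ p → degP p ≡ nothing → IsZeroP p
degP≡nothing⇒isZero []      _ k = refl
degP≡nothing⇒isZero (a ∷ p) h with degP p in eq
degP≡nothing⇒isZero (a ∷ p) () | just _
degP≡nothing⇒isZero (a ∷ p) h  | nothing with a ℤ.≟ 0ℤ
degP≡nothing⇒isZero (a ∷ p) h  | nothing | yes a≡0 = λ { zero → a≡0 ; (suc k) → degP≡nothing⇒isZero p eq k }
degP≡nothing⇒isZero (a ∷ p) () | nothing | no _

degP≡just⇒degP≤ : ∀ p {d} → degP p ≡ just d → DegP≤ p d
degP≡just⇒degP≤ (a ∷ p) h with degP p in eq
degP≡just⇒degP≤ (a ∷ p) refl | just d = λ { zero () ; (suc k) (s≤s d<k) → degP≡just⇒degP≤ p eq k d<k }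
degP≡just⇒degP≤ (a ∷ p) h    | nothing with a ℤ.≟ 0ℤ
degP≡just⇒degP≤ (a ∷ p) ()   | nothing | yes _
degP≡just⇒degP≤ (a ∷ p) refl | nothing | no _ = λ { zero () ; (suc k) _ → degP≡nothing⇒isZero p eq k }

degP≡just⇒coeff≢0 : ∀ p {d} → degP p ≡ just d → coeff p d ≢ 0ℤ
degP≡just⇒coeff≢0 (a ∷ p) h with degP p in eq
degP≡just⇒coeff≢0 (a ∷ p) refl | just d = degP≡just⇒coeff≢0 p eq
degP≡just⇒coeff≢0 (a ∷ p) h    | nothing with a ℤ.≟ 0ℤ
degP≡just⇒coeff≢0 (a ∷ p) ()   | nothing | yes _
degP≡just⇒coeff≢0 (a ∷ p) refl | nothing | no a≢0 = a≢0

isZero⇒degP≡nothing : ∀ p → IsZeroP p → degP p ≡ nothing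
isZero⇒degP≡nothing []      _   = refl
isZero⇒degP≡nothing (a ∷ p) p≡0 rewrite isZero⇒degP≡nothing p (λ k → p≡0 (suc k)) with a ℤ.≟ 0ℤ
... | yes _   = refl
... | no a≢0 = ⊥-elim (a≢0 (p≡0 0))

degP≤∧coeff≢0⇒degP≡just : ∀ p {d} → DegP≤ p d → coeff p d ≢ 0ℤ → degP p ≡ just d
degP≤∧coeff≢0⇒degP≡just []      bp c≢0 = ⊥-elim (c≢0 refl)
degP≤∧coeff≢0⇒degP≡just (a ∷ p) {zero} bp c≢0
  rewrite isZero⇒degP≡nothing p (degP≤-zero-tail a p bp) with a ℤ.≟ 0ℤ
... | yes a≡0 = ⊥-elim (c≢0 a≡0)
... | no _    = refl
degP≤∧coeff≢0⇒degP≡just (a ∷ p) {suc d} bp c≢0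
  rewrite degP≤∧coeff≢0⇒degP≡just p (λ k d<k → bp (suc k) (s≤s d<k)) c≢0 = refl

*P-top : ∀ p q {D E N} → N ≡ D ℕ.+ E → DegP≤ p D → DegP≤ q E →
  DegP≤ (p *P q) N × coeff (p *P q) N ≡ coeff p D ℤ.* coeff q E
*P-top p q refl bp bq = degP≤-*P p q bp bq , coeff-*P-top p q bp bq

degP-*P : ∀ p q {d e} → degP p ≡ just d → degP q ≡ just e → degP (p *P q) ≡ just (d ℕ.+ e)
degP-*P p q dp dq = degP≤∧coeff≢0⇒degP≡just (p *P q) (degP≤-*P p q bp bq) lead≢0
  where
  bp = degP≡just⇒degP≤ p dp
  bq = degP≡just⇒degP≤ q dq
  lead≢0 : coeff (p *P q) _ ≢ 0ℤ
  lead≢0 c≡0 with ℤP.i*j≡0⇒i≡0∨j≡0 _ (trans (sym (coeff-*P-top p q bp bq)) c≡0)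
  ... | inj₁ cp≡0 = degP≡just⇒coeff≢0 p dp cp≡0
  ... | inj₂ cq≡0 = degP≡just⇒coeff≢0 q dq cq≡0

maxM-≤M : ∀ x y {d} → maxM x y ≤M just d → x ≤M just d × y ≤M just d
maxM-≤M nothing  y        h = _ , h
maxM-≤M (just x) nothing  h = h , _
maxM-≤M (just x) (just y) h = ℕP.≤-trans (ℕP.m≤m⊔n x y) h , ℕP.≤-trans (ℕP.m≤n⊔m x y) h

degV-≤M : ∀ {m} (f : PVec m) {d} → degV f ≤M just d → ∀ c → degP (f c) ≤M just d
degV-≤M {suc m} f h zero    = proj₁ (maxM-≤M (degP (f zero)) _ h)
degV-≤M {suc m} f h (suc c) = degV-≤M (λ k → f (suc k)) (proj₂ (maxM-≤M (degP (f zero)) _ h)) c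

degP-≤M⇒degP≤ : ∀ p {d} → degP p ≤M just d → DegP≤ p d
degP-≤M⇒degP≤ p h with degP p in eq
... | nothing = λ k _ → degP≡nothing⇒isZero p eq k
... | just d′ = degP≤-mono p h (degP≡just⇒degP≤ p eq)

degV≡just⇒degP≤ : ∀ {m} (f : PVec m) {d} → degV f ≡ just d → ∀ c → DegP≤ (f c) d
degV≡just⇒degP≤ f {d} h c = degP-≤M⇒degP≤ (f c) (degV-≤M f (subst (_≤M just d) (sym h) ℕP.≤-refl) c)

pilot≡coeff : ∀ {m} (f : PVec m) {d} → degV f ≡ just d → ∀ c → pilot f c ≡ coeff (f c) d
pilot≡coeff f h c with degV f
pilot≡coeff f refl c | _ = refl

pilot≡0 : ∀ {m} (f : PVec m) → degV f ≡ nothing → ∀ c → pilot f c ≡ 0ℤ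
pilot≡0 f h c with degV f
pilot≡0 f refl c | _ = refl

-- Rational coefficients

ι : ℤ → ℚ
ι z = z ℚ./ 1

-- ℚ normalises by gcd, so the laws of ι are checked in ℚᵘ and pulled back along toℚᵘ.
private
  toℚᵘ-ι : ∀ z → ℚ.toℚᵘ (ι z) ℚᵘ.≃ ℚᵘ.mkℚᵘ z 0
  toℚᵘ-ι z = ℚP.toℚᵘ-fromℚᵘ (ℚᵘ.mkℚᵘ z 0)

ι-+ : ∀ a b → ι (a ℤ.+ b) ≡ ι a ℚ.+ ι b
ι-+ a b = ℚP.toℚᵘ-injective (ℚᵘP.≃-trans (toℚᵘ-ι (a ℤ.+ b))
  (ℚᵘP.≃-sym (ℚᵘP.≃-trans (ℚP.toℚᵘ-homo-+ (ι a) (ι b))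
                          (ℚᵘP.≃-trans (ℚᵘP.+-cong (toℚᵘ-ι a) (toℚᵘ-ι b)) (ℚᵘ.*≡* eq)))))
  where
  eq : (a ℤ.* 1ℤ ℤ.+ b ℤ.* 1ℤ) ℤ.* 1ℤ ≡ (a ℤ.+ b) ℤ.* 1ℤ
  eq rewrite ℤP.*-identityʳ a | ℤP.*-identityʳ b = refl

ι-* : ∀ a b → ι (a ℤ.* b) ≡ ι a ℚ.* ι b
ι-* a b = ℚP.toℚᵘ-injective (ℚᵘP.≃-trans (toℚᵘ-ι (a ℤ.* b))
  (ℚᵘP.≃-sym (ℚᵘP.≃-trans (ℚP.toℚᵘ-homo-* (ι a) (ι b))
                          (ℚᵘP.≃-trans (ℚᵘP.*-cong (toℚᵘ-ι a) (toℚᵘ-ι b)) (ℚᵘ.*≡* refl)))))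

ι-neg : ∀ a → ι (ℤ.- a) ≡ ℚ.- ι a
ι-neg a = ℚP.toℚᵘ-injective (ℚᵘP.≃-trans (toℚᵘ-ι (ℤ.- a))
  (ℚᵘP.≃-sym (ℚᵘP.≃-trans (ℚP.toℚᵘ-homo‿- (ι a))
                          (ℚᵘP.≃-trans (ℚᵘP.-‿cong (toℚᵘ-ι a)) (ℚᵘ.*≡* refl)))))

ι-injective : ∀ {a b} → ι a ≡ ι b → a ≡ b
ι-injective {a} {b} h with ℚᵘP.≃-trans (ℚᵘP.≃-sym (toℚᵘ-ι a)) (ℚᵘP.≃-trans (ℚP.toℚᵘ-cong h) (toℚᵘ-ι b))
... | ℚᵘ.*≡* e = trans (sym (ℤP.*-identityʳ a)) (trans e (ℤP.*-identityʳ b))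

ι-≢0 : ∀ {a} → a ≢ 0ℤ → ι a ≢ 0ℚ
ι-≢0 a≢0 e = a≢0 (ι-injective e)

ι-sumℤ : ∀ {n} (f : Fin n → ℤ) → ι (sumℤ f) ≡ sum (λ i → ι (f i))
ι-sumℤ {zero}  f = refl
ι-sumℤ {suc n} f = trans (ι-+ (f zero) _) (cong (ι (f zero) ℚ.+_) (ι-sumℤ (λ i → f (suc i))))

*-ι-↧≡ι-↥ : ∀ q → q ℚ.* ι (ℚ.↧ q) ≡ ι (ℚ.↥ q)
*-ι-↧≡ι-↥ q@record{} = ℚP.toℚᵘ-injective (ℚᵘP.≃-trans (ℚP.toℚᵘ-homo-* q (ι (ℚ.↧ q)))
  (ℚᵘP.≃-trans (ℚᵘP.*-cong (ℚᵘP.≃-refl {ℚ.toℚᵘ q}) (toℚᵘ-ι (ℚ.↧ q)))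
               (ℚᵘP.≃-trans (ℚᵘ.*≡* eq) (ℚᵘP.≃-sym (toℚᵘ-ι (ℚ.↥ q))))))
  where
  eq : (ℚ.↥ q ℤ.* ℚ.↧ q) ℤ.* 1ℤ ≡ ℚ.↥ q ℤ.* (ℚ.↧ q ℤ.* 1ℤ)
  eq = trans (ℤP.*-identityʳ _) (cong (ℚ.↥ q ℤ.*_) (sym (ℤP.*-identityʳ _)))

_÷_[_] : ℚ → (β : ℚ) → β ≢ 0ℚ → ℚ
α ÷ β [ β≢0 ] = α ℚ.* ℚ.1/_ β {{ℚ.≢-nonZero β≢0}}

÷-*-cancel : ∀ α β (β≢0 : β ≢ 0ℚ) → (α ÷ β [ β≢0 ]) ℚ.* β ≡ α
÷-*-cancel α β β≢0 = trans (ℚP.*-assoc α _ β)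
  (trans (cong (α ℚ.*_) (ℚP.*-inverseˡ β {{ℚ.≢-nonZero β≢0}})) (ℚP.*-identityʳ α))

x*y≡0⇒x≡0∨y≡0 : ∀ x y → x ℚ.* y ≡ 0ℚ → x ≡ 0ℚ ⊎ y ≡ 0ℚ
x*y≡0⇒x≡0∨y≡0 x y xy≡0 with x ℚP.≟ 0ℚ
... | yes x≡0 = inj₁ x≡0
... | no  x≢0 = inj₂ (begin
  y                 ≡⟨ sym (ℚP.*-identityˡ y) ⟩
  1ℚ ℚ.* y          ≡⟨ cong (ℚ._* y) (sym (ℚP.*-inverseˡ x)) ⟩
  (x⁻¹ ℚ.* x) ℚ.* y ≡⟨ ℚP.*-assoc x⁻¹ x y ⟩
  x⁻¹ ℚ.* (x ℚ.* y) ≡⟨ cong (x⁻¹ ℚ.*_) xy≡0 ⟩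
  x⁻¹ ℚ.* 0ℚ        ≡⟨ ℚP.*-zeroʳ x⁻¹ ⟩
  0ℚ                ∎)
  where
  open ≡-Reasoning
  instance _ = ℚ.≢-nonZero x≢0
  x⁻¹ = ℚ.1/ x

*-≢0 : ∀ {x y} → x ≢ 0ℚ → y ≢ 0ℚ → x ℚ.* y ≢ 0ℚ
*-≢0 {x} {y} x≢0 y≢0 xy≡0 with x*y≡0⇒x≡0∨y≡0 x y xy≡0
... | inj₁ x≡0 = x≢0 x≡0
... | inj₂ y≡0 = y≢0 y≡0

sum-zero : ∀ {n} (f : Fin n → ℚ) → (∀ i → f i ≡ 0ℚ) → sum f ≡ 0ℚ
sum-zero {n} f f≡0 = trans (sum-cong-≗ f≡0) (sum-replicate-zero n)

sum-neg : ∀ {n} (f : Fin n → ℚ) → sum (λ i → ℚ.- f i) ≡ ℚ.- sum f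
sum-neg {zero}  f = refl
sum-neg {suc n} f = trans (cong (ℚ.- f zero ℚ.+_) (sum-neg (λ i → f (suc i)))) (sym (ℚP.neg-distrib-+ (f zero) _))

δ : ∀ {n} → Fin n → Fin n → ℚ
δ zero    zero    = 1ℚ
δ zero    (suc _) = 0ℚ
δ (suc _) zero    = 0ℚ
δ (suc k) (suc l) = δ k l

δ-diag : ∀ {n} (k : Fin n) → δ k k ≡ 1ℚ
δ-diag zero    = refl
δ-diag (suc k) = δ-diag k

δ-off : ∀ {n} {k l : Fin n} → k ≢ l → δ k l ≡ 0ℚ
δ-off {k = zero}  {zero}  k≢l = ⊥-elim (k≢l refl)
δ-off {k = zero}  {suc l} k≢l = refl
δ-off {k = suc k} {zero}  k≢l = refl
δ-off {k = suc k} {suc l} k≢l = δ-off (λ k≡l → k≢l (cong suc k≡l))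

sum-δ* : ∀ {n} (k : Fin n) (f : Fin n → ℚ) → sum (λ l → δ k l ℚ.* f l) ≡ f k
sum-δ* zero f = begin
  1ℚ ℚ.* f zero ℚ.+ sum (λ l → 0ℚ ℚ.* f (suc l))
    ≡⟨ cong₂ ℚ._+_ (ℚP.*-identityˡ (f zero)) (sum-zero _ (λ l → ℚP.*-zeroˡ (f (suc l)))) ⟩
  f zero ℚ.+ 0ℚ
    ≡⟨ ℚP.+-identityʳ (f zero) ⟩
  f zero
    ∎
  where open ≡-Reasoning
sum-δ* (suc k) f = begin
  0ℚ ℚ.* f zero ℚ.+ sum (λ l → δ k l ℚ.* f (suc l))
    ≡⟨ cong₂ ℚ._+_ (ℚP.*-zeroˡ (f zero)) (sum-δ* k (λ l → f (suc l))) ⟩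
  0ℚ ℚ.+ f (suc k)
    ≡⟨ ℚP.+-identityˡ (f (suc k)) ⟩
  f (suc k)
    ∎
  where open ≡-Reasoning

0≤x*x : ∀ x → 0ℚ ℚ.≤ x ℚ.* x
0≤x*x x with ℚP.≤-total 0ℚ x
... | inj₁ 0≤x = ℚP.nonNegative⁻¹ _ {{ℚP.nonNeg*nonNeg⇒nonNeg x {{ℚ.nonNegative 0≤x}} x {{ℚ.nonNegative 0≤x}}}}
... | inj₂ x≤0 = ℚP.nonNegative⁻¹ _ {{ℚP.nonPos*nonPos⇒nonPos x {{ℚ.nonPositive x≤0}} x {{ℚ.nonPositive x≤0}}}}

sum-squares-nonNeg : ∀ {n} (f : Fin n → ℚ) → 0ℚ ℚ.≤ sum (λ i → f i ℚ.* f i)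
sum-squares-nonNeg {zero}  f = ℚP.≤-refl
sum-squares-nonNeg {suc n} f =
  ℚP.+-mono-≤ (0≤x*x (f zero)) (sum-squares-nonNeg (λ i → f (suc i)))

nonNeg+nonNeg≡0⇒≡0 : ∀ {a b} → 0ℚ ℚ.≤ a → 0ℚ ℚ.≤ b → a ℚ.+ b ≡ 0ℚ → a ≡ 0ℚ × b ≡ 0ℚ
nonNeg+nonNeg≡0⇒≡0 {a} {b} 0≤a 0≤b a+b≡0 = ℚP.≤-antisym a≤0 0≤a , ℚP.≤-antisym b≤0 0≤b
  where
  open ℚP.≤-Reasoning
  a≤0 : a ℚ.≤ 0ℚ
  a≤0 = begin
    a         ≡⟨ ℚP.+-identityʳ a ⟨
    a ℚ.+ 0ℚ  ≤⟨ ℚP.+-monoʳ-≤ a 0≤b ⟩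
    a ℚ.+ b   ≡⟨ a+b≡0 ⟩
    0ℚ        ∎
  b≤0 : b ℚ.≤ 0ℚ
  b≤0 = begin
    b         ≡⟨ ℚP.+-identityˡ b ⟨
    0ℚ ℚ.+ b  ≤⟨ ℚP.+-monoˡ-≤ b 0≤a ⟩
    a ℚ.+ b   ≡⟨ a+b≡0 ⟩
    0ℚ        ∎

x*x≡0⇒x≡0 : ∀ x → x ℚ.* x ≡ 0ℚ → x ≡ 0ℚ
x*x≡0⇒x≡0 x xx≡0 with x*y≡0⇒x≡0∨y≡0 x x xx≡0
... | inj₁ x≡0 = x≡0
... | inj₂ x≡0 = x≡0

sum-squares≡0⇒≡0 : ∀ {n} (f : Fin n → ℚ) → sum (λ i → f i ℚ.* f i) ≡ 0ℚ → ∀ i → f i ≡ 0ℚ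
sum-squares≡0⇒≡0 f s≡0 zero    =
  x*x≡0⇒x≡0 (f zero) (proj₁ (nonNeg+nonNeg≡0⇒≡0 (0≤x*x (f zero)) (sum-squares-nonNeg (λ i → f (suc i))) s≡0))
sum-squares≡0⇒≡0 f s≡0 (suc i) = sum-squares≡0⇒≡0 (λ i → f (suc i))
  (proj₂ (nonNeg+nonNeg≡0⇒≡0 (0≤x*x (f zero)) (sum-squares-nonNeg (λ i → f (suc i))) s≡0)) i

LinIndepℚ : ∀ {n m} → (Fin n → Fin m → ℚ) → Set
LinIndepℚ {n} {m} v = (μ : Fin n → ℚ) → (∀ k → sum (λ i → μ i ℚ.* v i k) ≡ 0ℚ) → ∀ i → μ i ≡ 0ℚ

clearDenominators : ∀ {n} (μ : Fin n → ℚ) →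
  Σ ℤ λ D → D ≢ 0ℤ × Σ (Fin n → ℤ) λ a → ∀ i → ι (a i) ≡ ι D ℚ.* μ i
clearDenominators {zero}  μ = 1ℤ , (λ ()) , (λ ()) , (λ ())
clearDenominators {suc n} μ with clearDenominators (λ i → μ (suc i))
... | D , D≢0 , a , ιa≡Dμ = D ℤ.* ℚ.↧ q , D↧q≢0 , a′ , ιa′≡D↧qμ
  where
  open +-*-Solver
  swap : ∀ x y z → (x ℚ.* y) ℚ.* z ≡ (x ℚ.* z) ℚ.* y
  swap = solve 3 (λ x y z → (x :* y) :* z := (x :* z) :* y) refl
  rotate : ∀ x y z → x ℚ.* (y ℚ.* z) ≡ (x ℚ.* z) ℚ.* y
  rotate = solve 3 (λ x y z → x :* (y :* z) := (x :* z) :* y) refl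
  q = μ zero
  D↧q≢0 : D ℤ.* ℚ.↧ q ≢ 0ℤ
  D↧q≢0 e with ℤP.i*j≡0⇒i≡0∨j≡0 D e
  ... | inj₁ D≡0 = D≢0 D≡0
  ... | inj₂ ()
  a′ : Fin (suc n) → ℤ
  a′ zero    = D ℤ.* ℚ.↥ q
  a′ (suc i) = a i ℤ.* ℚ.↧ q
  ιa′≡D↧qμ : ∀ i → ι (a′ i) ≡ ι (D ℤ.* ℚ.↧ q) ℚ.* μ i
  ιa′≡D↧qμ zero = begin
    ι (D ℤ.* ℚ.↥ q)              ≡⟨ ι-* D (ℚ.↥ q) ⟩
    ι D ℚ.* ι (ℚ.↥ q)            ≡⟨ cong (ι D ℚ.*_) (sym (*-ι-↧≡ι-↥ q)) ⟩
    ι D ℚ.* (q ℚ.* ι (ℚ.↧ q))    ≡⟨ rotate (ι D) q (ι (ℚ.↧ q)) ⟩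
    (ι D ℚ.* ι (ℚ.↧ q)) ℚ.* q    ≡⟨ cong (ℚ._* q) (sym (ι-* D (ℚ.↧ q))) ⟩
    ι (D ℤ.* ℚ.↧ q) ℚ.* q        ∎
    where open ≡-Reasoning
  ιa′≡D↧qμ (suc i) = begin
    ι (a i ℤ.* ℚ.↧ q)                  ≡⟨ ι-* (a i) (ℚ.↧ q) ⟩
    ι (a i) ℚ.* ι (ℚ.↧ q)              ≡⟨ cong (ℚ._* ι (ℚ.↧ q)) (ιa≡Dμ i) ⟩
    (ι D ℚ.* μ (suc i)) ℚ.* ι (ℚ.↧ q)  ≡⟨ swap (ι D) (μ (suc i)) (ι (ℚ.↧ q)) ⟩
    (ι D ℚ.* ι (ℚ.↧ q)) ℚ.* μ (suc i)  ≡⟨ cong (ℚ._* μ (suc i)) (sym (ι-* D (ℚ.↧ q))) ⟩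
    ι (D ℤ.* ℚ.↧ q) ℚ.* μ (suc i)      ∎
    where open ≡-Reasoning

LinIndep⇒LinIndepℚ : ∀ {n m} (v : Fin n → Fin m → ℤ) → LinIndep v → LinIndepℚ (λ i k → ι (v i k))
LinIndep⇒LinIndepℚ v indep μ μv≡0 i with clearDenominators μ
... | D , D≢0 , a , ιa≡Dμ with x*y≡0⇒x≡0∨y≡0 (ι D) (μ i) (trans (sym (ιa≡Dμ i)) (cong ι (indep a av≡0 i)))
  where
  av≡0 : ∀ k → sumℤ (λ i → a i ℤ.* v i k) ≡ 0ℤ
  av≡0 k = ι-injective (begin
    ι (sumℤ (λ i → a i ℤ.* v i k))          ≡⟨ ι-sumℤ (λ i → a i ℤ.* v i k) ⟩
    sum (λ i → ι (a i ℤ.* v i k))           ≡⟨ sum-cong-≗ ιav≡Dμv ⟩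
    sum (λ i → ι D ℚ.* (μ i ℚ.* ι (v i k))) ≡⟨ sym (*-distribˡ-sum (ι D) (λ i → μ i ℚ.* ι (v i k))) ⟩
    ι D ℚ.* sum (λ i → μ i ℚ.* ι (v i k))   ≡⟨ cong (ι D ℚ.*_) (μv≡0 k) ⟩
    ι D ℚ.* 0ℚ                              ≡⟨ ℚP.*-zeroʳ (ι D) ⟩
    0ℚ                                      ∎)
    where
    open ≡-Reasoning
    ιav≡Dμv : ∀ i → ι (a i ℤ.* v i k) ≡ ι D ℚ.* (μ i ℚ.* ι (v i k))
    ιav≡Dμv i = trans (ι-* (a i) (v i k)) (trans (cong (ℚ._* ι (v i k)) (ιa≡Dμ i)) (ℚP.*-assoc (ι D) (μ i) _))
... | inj₁ ιD≡0 = ⊥-elim (ι-≢0 D≢0 ιD≡0)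
... | inj₂ μi≡0 = μi≡0

-- Top terms of rational functions

-- r = α t^D + (terms of lower degree), α = 0 allowed, stated on r = a / b without division:
-- with e = deg b, the coefficients of a vanish above D + e and the one at D + e is α · lc b.
record TopTerm (r : RF) (D : ℕ) (α : ℚ) : Set where
  constructor topTerm
  field
    degDen    : ℕ
    degP-den  : degP (den r) ≡ just degDen
    degP≤-num : DegP≤ (num r) (D ℕ.+ degDen)
    top-num   : α ℚ.* ι (coeff (den r) degDen) ≡ ι (coeff (num r) (D ℕ.+ degDen))

topTerm-0RF : ∀ D → TopTerm 0RF D 0ℚ
topTerm-0RF D = topTerm 0 refl (λ _ _ → refl) (ℚP.*-zeroˡ 1ℚ)

topTerm-fromPoly : ∀ p {D} → DegP≤ p D → TopTerm (fromPoly p) D (ι (coeff p D))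
topTerm-fromPoly p {D} bp = topTerm 0 refl (subst (DegP≤ p) (sym D+0≡D) bp)
  (trans (ℚP.*-identityʳ _) (cong (λ k → ι (coeff p k)) (sym D+0≡D)))
  where D+0≡D = ℕP.+-identityʳ D

topTerm-+R : ∀ {x y D α γ} → TopTerm x D α → TopTerm y D γ → TopTerm (x +R y) D (α ℚ.+ γ)
topTerm-+R {a // b} {c // d} {D} {α} {γ} (topTerm eb db ba ta) (topTerm ed dd bc tc) =
  topTerm (eb ℕ.+ ed) (degP-*P b d db dd) (degP≤-+P (a *P d) (c *P b) (proj₁ ad) (proj₁ cb)) top
  where
  open +-*-Solver
  open ≡-Reasoning
  N = D ℕ.+ (eb ℕ.+ ed)
  ad = *P-top a d {D ℕ.+ eb} {ed} (sym (ℕP.+-assoc D eb ed)) ba (degP≡just⇒degP≤ d dd)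
  cb = *P-top c b {D ℕ.+ ed} {eb} (trans (cong (D ℕ.+_) (ℕP.+-comm eb ed)) (sym (ℕP.+-assoc D ed eb))) bc (degP≡just⇒degP≤ b db)
  lb = coeff b eb
  ld = coeff d ed
  top : (α ℚ.+ γ) ℚ.* ι (coeff (b *P d) (eb ℕ.+ ed)) ≡ ι (coeff ((a *P d) +P (c *P b)) N)
  top = begin
    (α ℚ.+ γ) ℚ.* ι (coeff (b *P d) (eb ℕ.+ ed))
      ≡⟨ cong (λ z → (α ℚ.+ γ) ℚ.* ι z) (coeff-*P-top b d (degP≡just⇒degP≤ b db) (degP≡just⇒degP≤ d dd)) ⟩
    (α ℚ.+ γ) ℚ.* ι (lb ℤ.* ld)
      ≡⟨ cong ((α ℚ.+ γ) ℚ.*_) (ι-* lb ld) ⟩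
    (α ℚ.+ γ) ℚ.* (ι lb ℚ.* ι ld)
      ≡⟨ solve 4 (λ α γ B D → (α :+ γ) :* (B :* D) := (α :* B) :* D :+ (γ :* D) :* B) refl α γ (ι lb) (ι ld) ⟩
    (α ℚ.* ι lb) ℚ.* ι ld ℚ.+ (γ ℚ.* ι ld) ℚ.* ι lb
      ≡⟨ cong₂ (λ u v → u ℚ.* ι ld ℚ.+ v ℚ.* ι lb) ta tc ⟩
    ι (coeff a (D ℕ.+ eb)) ℚ.* ι ld ℚ.+ ι (coeff c (D ℕ.+ ed)) ℚ.* ι lb
      ≡⟨ sym (cong₂ ℚ._+_ (ι-* (coeff a (D ℕ.+ eb)) ld) (ι-* (coeff c (D ℕ.+ ed)) lb)) ⟩
    ι (coeff a (D ℕ.+ eb) ℤ.* ld) ℚ.+ ι (coeff c (D ℕ.+ ed) ℤ.* lb)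
      ≡⟨ sym (ι-+ (coeff a (D ℕ.+ eb) ℤ.* ld) (coeff c (D ℕ.+ ed) ℤ.* lb)) ⟩
    ι (coeff a (D ℕ.+ eb) ℤ.* ld ℤ.+ coeff c (D ℕ.+ ed) ℤ.* lb)
      ≡⟨ cong ι (sym (trans (coeff-+P (a *P d) (c *P b) N) (cong₂ ℤ._+_ (proj₂ ad) (proj₂ cb)))) ⟩
    ι (coeff ((a *P d) +P (c *P b)) N)
      ∎

topTerm--R : ∀ {x D α} → TopTerm x D α → TopTerm (-R x) D (ℚ.- α)
topTerm--R {a // b} {D} {α} (topTerm eb db ba ta) = topTerm eb db (degP≤-negP a ba) (begin
  ℚ.- α ℚ.* ι (coeff b eb)         ≡⟨ sym (ℚP.neg-distribˡ-* α _) ⟩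
  ℚ.- (α ℚ.* ι (coeff b eb))       ≡⟨ cong ℚ.-_ ta ⟩
  ℚ.- ι (coeff a (D ℕ.+ eb))       ≡⟨ sym (ι-neg (coeff a (D ℕ.+ eb))) ⟩
  ι (ℤ.- coeff a (D ℕ.+ eb))       ≡⟨ cong ι (sym (coeff-negP a _)) ⟩
  ι (coeff (negP a) (D ℕ.+ eb))    ∎)
  where open ≡-Reasoning

topTerm-*R : ∀ {x y D E α γ} → TopTerm x D α → TopTerm y E γ → TopTerm (x *R y) (D ℕ.+ E) (α ℚ.* γ)
topTerm-*R {a // b} {c // d} {D} {E} {α} {γ} (topTerm eb db ba ta) (topTerm ed dd bc tc) =
  topTerm (eb ℕ.+ ed) (degP-*P b d db dd) (proj₁ ac) top
  where
  open +-*-Solver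
  open ≡-Reasoning
  index : ∀ D E eb ed → (D ℕ.+ E) ℕ.+ (eb ℕ.+ ed) ≡ (D ℕ.+ eb) ℕ.+ (E ℕ.+ ed)
  index = solve-∀
  ac = *P-top a c {D ℕ.+ eb} {E ℕ.+ ed} (index D E eb ed) ba bc
  lb = coeff b eb
  ld = coeff d ed
  top : (α ℚ.* γ) ℚ.* ι (coeff (b *P d) (eb ℕ.+ ed)) ≡ ι (coeff (a *P c) ((D ℕ.+ E) ℕ.+ (eb ℕ.+ ed)))
  top = begin
    (α ℚ.* γ) ℚ.* ι (coeff (b *P d) (eb ℕ.+ ed))
      ≡⟨ cong (λ z → (α ℚ.* γ) ℚ.* ι z) (coeff-*P-top b d (degP≡just⇒degP≤ b db) (degP≡just⇒degP≤ d dd)) ⟩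
    (α ℚ.* γ) ℚ.* ι (lb ℤ.* ld)
      ≡⟨ cong ((α ℚ.* γ) ℚ.*_) (ι-* lb ld) ⟩
    (α ℚ.* γ) ℚ.* (ι lb ℚ.* ι ld)
      ≡⟨ solve 4 (λ α γ B D → (α :* γ) :* (B :* D) := (α :* B) :* (γ :* D)) refl α γ (ι lb) (ι ld) ⟩
    (α ℚ.* ι lb) ℚ.* (γ ℚ.* ι ld)
      ≡⟨ cong₂ ℚ._*_ ta tc ⟩
    ι (coeff a (D ℕ.+ eb)) ℚ.* ι (coeff c (E ℕ.+ ed))
      ≡⟨ sym (ι-* (coeff a (D ℕ.+ eb)) (coeff c (E ℕ.+ ed))) ⟩
    ι (coeff a (D ℕ.+ eb) ℤ.* coeff c (E ℕ.+ ed))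
      ≡⟨ cong ι (sym (proj₂ ac)) ⟩
    ι (coeff (a *P c) ((D ℕ.+ E) ℕ.+ (eb ℕ.+ ed)))
      ∎

topTerm⇒degP-num : ∀ {y B β} (t : TopTerm y B β) → β ≢ 0ℚ → degP (num y) ≡ just (B ℕ.+ TopTerm.degDen t)
topTerm⇒degP-num {c // d} (topTerm ed dd bc tc) β≢0 = degP≤∧coeff≢0⇒degP≡just c bc
  (λ c≡0 → *-≢0 β≢0 (ι-≢0 (degP≡just⇒coeff≢0 d dd)) (trans tc (cong ι c≡0)))

topTerm-/R : ∀ {x y C B α β} (β≢0 : β ≢ 0ℚ) → TopTerm x (C ℕ.+ B) α → TopTerm y B β →
  TopTerm (x /R y) C (α ÷ β [ β≢0 ])
topTerm-/R {a // b} {c // d} {C} {B} {α} {β} β≢0 (topTerm eb db ba ta) ty@(topTerm ed dd bc tc)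
  with degP c | topTerm⇒degP-num ty β≢0
... | just _ | refl = topTerm (eb ℕ.+ (B ℕ.+ ed)) (degP-*P b c db (topTerm⇒degP-num ty β≢0)) (proj₁ ad) top
  where
  open +-*-Solver
  open ≡-Reasoning
  index : ∀ C B eb ed → C ℕ.+ (eb ℕ.+ (B ℕ.+ ed)) ≡ ((C ℕ.+ B) ℕ.+ eb) ℕ.+ ed
  index = solve-∀
  ad = *P-top a d {(C ℕ.+ B) ℕ.+ eb} {ed} (index C B eb ed) ba (degP≡just⇒degP≤ d dd)
  lb = coeff b eb
  ld = coeff d ed
  tb = coeff c (B ℕ.+ ed)
  q = α ÷ β [ β≢0 ]
  top : q ℚ.* ι (coeff (b *P c) (eb ℕ.+ (B ℕ.+ ed))) ≡ ι (coeff (a *P d) (C ℕ.+ (eb ℕ.+ (B ℕ.+ ed))))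
  top = begin
    q ℚ.* ι (coeff (b *P c) (eb ℕ.+ (B ℕ.+ ed))) ≡⟨ cong (λ z → q ℚ.* ι z) (coeff-*P-top b c (degP≡just⇒degP≤ b db) bc) ⟩
    q ℚ.* ι (lb ℤ.* tb)                          ≡⟨ cong (q ℚ.*_) (ι-* lb tb) ⟩
    q ℚ.* (ι lb ℚ.* ι tb)                        ≡⟨ cong (λ z → q ℚ.* (ι lb ℚ.* z)) (sym tc) ⟩
    q ℚ.* (ι lb ℚ.* (β ℚ.* ι ld))                ≡⟨ solve 4 (λ q β B D → q :* (B :* (β :* D)) := ((q :* β) :* B) :* D) refl q β (ι lb) (ι ld) ⟩
    ((q ℚ.* β) ℚ.* ι lb) ℚ.* ι ld                ≡⟨ cong (λ z → (z ℚ.* ι lb) ℚ.* ι ld) (÷-*-cancel α β β≢0) ⟩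
    (α ℚ.* ι lb) ℚ.* ι ld                        ≡⟨ cong (ℚ._* ι ld) ta ⟩
    ι (coeff a ((C ℕ.+ B) ℕ.+ eb)) ℚ.* ι ld      ≡⟨ sym (ι-* (coeff a ((C ℕ.+ B) ℕ.+ eb)) ld) ⟩
    ι (coeff a ((C ℕ.+ B) ℕ.+ eb) ℤ.* ld)        ≡⟨ cong ι (sym (proj₂ ad)) ⟩
    ι (coeff (a *P d) (C ℕ.+ (eb ℕ.+ (B ℕ.+ ed)))) ∎

topTerm-0⇒lower : ∀ {x D} → TopTerm x (suc D) 0ℚ → Σ ℚ (TopTerm x D)
topTerm-0⇒lower {a // b} {D} (topTerm eb db ba ta) =
  ι (coeff a (D ℕ.+ eb)) ÷ ι lb [ lb≢0 ] , topTerm eb db ba′ (÷-*-cancel _ _ lb≢0)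
  where
  lb = coeff b eb
  lb≢0 = ι-≢0 (degP≡just⇒coeff≢0 b db)
  top≡0 : coeff a (suc D ℕ.+ eb) ≡ 0ℤ
  top≡0 = ι-injective (trans (sym ta) (ℚP.*-zeroˡ (ι lb)))
  ba′ : DegP≤ a (D ℕ.+ eb)
  ba′ k D+eb<k with ℕP.m≤n⇒m<n∨m≡n D+eb<k
  ... | inj₁ 1+D+eb<k = ba k 1+D+eb<k
  ... | inj₂ refl     = top≡0

topTerm-sumR : ∀ {n D} (f : Fin n → RF) (α : Fin n → ℚ) → (∀ i → TopTerm (f i) D (α i)) → TopTerm (sumR f) D (sum α)
topTerm-sumR {zero}  {D} f α t = topTerm-0RF D
topTerm-sumR {suc n}     f α t = topTerm-+R (t zero) (topTerm-sumR (λ i → f (suc i)) (λ i → α (suc i)) (λ i → t (suc i)))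

topTerm-dotR : ∀ {m D E} (u v : RVec m) (α β : Fin m → ℚ) → (∀ c → TopTerm (u c) D (α c)) → (∀ c → TopTerm (v c) E (β c)) →
  TopTerm (dotR u v) (D ℕ.+ E) (sum (λ c → α c ℚ.* β c))
topTerm-dotR u v α β tu tv = topTerm-sumR _ _ (λ c → topTerm-*R (tu c) (tv c))

topTerm⇒degR< : ∀ {r D α} → TopTerm r D α → degR r <M (+ suc D)
topTerm⇒degR< {a // b} {D} (topTerm e db ba _) with degP a in da | degP b | db
... | nothing | _       | _    = _
... | just d  | just .e | refl = ℤP.≤-<-trans d-e≤D (ℤ.+<+ (ℕP.n<1+n D))
  where
  d≤D+e : d ℕ.≤ D ℕ.+ e
  d≤D+e = ℕP.≮⇒≥ (λ D+e<d → degP≡just⇒coeff≢0 a da (ba d D+e<d))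
  d-e≤D : + d - + e ℤ.≤ + D
  d-e≤D = begin
    + d - + e          ≡⟨ ℤP.m-n≡m⊖n d e ⟩
    d ℤ.⊖ e            ≤⟨ ℤP.⊖-monoˡ-≤ e d≤D+e ⟩
    (D ℕ.+ e) ℤ.⊖ e    ≡⟨ ℤP.⊖-≥ (ℕP.m≤n+m e D) ⟩
    + (D ℕ.+ e ℕ.∸ e)  ≡⟨ cong +_ (ℕP.m+n∸n≡m D e) ⟩
    + D                ∎
    where open ℤP.≤-Reasoning

TopTermVec : ∀ {m} → RVec m → ℕ → (Fin m → ℚ) → Set
TopTermVec v D w = ∀ c → TopTerm (v c) D (w c)

topTerm-gsCoef : ∀ {m C E} {u v : RVec m} {p q : Fin m → ℚ} → TopTermVec u (C ℕ.+ E) p → TopTermVec v E q →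
  (q·q≢0 : sum (λ c → q c ℚ.* q c) ≢ 0ℚ) →
  TopTerm (gsCoef u v) C (sum (λ c → p c ℚ.* q c) ÷ sum (λ c → q c ℚ.* q c) [ q·q≢0 ])
topTerm-gsCoef {C = C} {E} {u} {v} {p} {q} tu tv q·q≢0 = topTerm-/R q·q≢0
  (subst (λ D → TopTerm (dotR u v) D (sum (λ c → p c ℚ.* q c))) (ℕP.+-assoc C E E) (topTerm-dotR u v p q tu tv))
  (topTerm-dotR v v q q tv tv)

gsCoef-degR< : ∀ {m D E} {u v : RVec m} {p q : Fin m → ℚ} → E ℕ.< D → TopTermVec u D p → TopTermVec v E q →
  sum (λ c → q c ℚ.* q c) ≢ 0ℚ → sum (λ c → p c ℚ.* q c) ≡ 0ℚ → degR (gsCoef u v) <M (+ D - + E)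
gsCoef-degR< {D = D} {E} {u} {v} {p} {q} E<D tu tv q·q≢0 p·q≡0 =
  subst (degR (gsCoef u v) <M_) 1+C≡D-E
    (topTerm⇒degR< (topTerm-/R q·q≢0 (subst (λ D → TopTerm (dotR u v) D (proj₁ lowered)) (ℕP.+-assoc C E E) (proj₂ lowered))
                                     (topTerm-dotR v v q q tv tv)))
  where
  C = D ℕ.∸ suc E
  D+E≡1+C+E+E : D ℕ.+ E ≡ suc (C ℕ.+ E ℕ.+ E)
  D+E≡1+C+E+E = cong (ℕ._+ E) (trans (sym (ℕP.m∸n+n≡m E<D)) (ℕP.+-suc C E))
  lowered = topTerm-0⇒lower (subst₂ (TopTerm (dotR u v)) D+E≡1+C+E+E p·q≡0 (topTerm-dotR u v p q tu tv))
  1+C≡D-E : + suc C ≡ + D - + E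
  1+C≡D-E = begin
    + suc C        ≡⟨ cong +_ (sym (ℕP.+-∸-assoc 1 E<D)) ⟩
    + (D ℕ.∸ E)    ≡⟨ sym (ℤP.⊖-≥ (ℕP.<⇒≤ E<D)) ⟩
    D ℤ.⊖ E        ≡⟨ sym (ℤP.m-n≡m⊖n D E) ⟩
    + D - + E      ∎
    where open ≡-Reasoning

topTerm-foldr : ∀ {m D} (S : (Fin m → ℚ) → Set) → S (λ _ → 0ℚ) → (∀ {u w} → S u → S w → S (λ c → u c ℚ.+ w c)) →
  (t : RVec m → RVec m) {gs : List (RVec m)} → All (λ g → Σ (Fin m → ℚ) λ w → S w × TopTermVec (t g) D w) gs →
  Σ (Fin m → ℚ) λ w → S w × TopTermVec (λ c → foldr (λ g acc → t g c +R acc) 0RF gs) D w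
topTerm-foldr {D = D} S S-0 S-+ t []                  = (λ _ → 0ℚ) , S-0 , (λ _ → topTerm-0RF D)
topTerm-foldr         S S-0 S-+ t ((w , sw , tw) ∷ ts) with topTerm-foldr S S-0 S-+ t ts
... | w′ , sw′ , tw′ = (λ c → w c ℚ.+ w′ c) , S-+ sw sw′ , (λ c → topTerm-+R (tw c) (tw′ c))

topTerm-reduce : ∀ {m D} (S : (Fin m → ℚ) → Set) → S (λ _ → 0ℚ) → (∀ {u w} → S u → S w → S (λ c → u c ℚ.+ w c)) →
  (f : RVec m) {p : Fin m → ℚ} {gs : List (RVec m)} → TopTermVec f D p →
  All (λ g → Σ (Fin m → ℚ) λ w → S w × TopTermVec (λ c → gsCoef f g *R g c) D w) gs →
  Σ (Fin m → ℚ) λ w → S w × TopTermVec (reduce f gs) D (λ c → p c ℚ.+ ℚ.- w c)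
topTerm-reduce S S-0 S-+ f tf ts with topTerm-foldr S S-0 S-+ (λ g c → gsCoef f g *R g c) ts
... | w , sw , tw = w , sw , λ c → topTerm-+R (tf c) (topTerm--R (tw c))

-- Gram–Schmidt

at-toℕ : ∀ {n m} (B : Fin n → PVec m) (l : Fin n) → at B (F.toℕ l) ≡ toR (B l)
at-toℕ {n} B l with F.toℕ l ℕ.<? n
... | yes l<n = cong (λ i → toR (B i)) (FP.fromℕ<-toℕ l l<n)
... | no  l≮n = ⊥-elim (l≮n (FP.toℕ<n l))

starsBefore-suc : ∀ {n m} (B : Fin n → PVec m) (l : Fin n) →
  starsBefore B (suc (F.toℕ l)) ≡ starsBefore B (F.toℕ l) ++ [ gsStar B l ]
starsBefore-suc B l = cong (λ f → starsBefore B (F.toℕ l) ++ [ reduce f (starsBefore B (F.toℕ l)) ]) (at-toℕ B l)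

All-starsBefore : ∀ {n m} (B : Fin n → PVec m) (Q : RVec m → Set) j → j ℕ.≤ n →
  (∀ l → F.toℕ l ℕ.< j → Q (gsStar B l)) → All Q (starsBefore B j)
All-starsBefore B Q zero    _   _  = []
All-starsBefore B Q (suc j) j<n Q* =
  subst (All Q) (sym stars≡) (++⁺ (All-starsBefore B Q j (ℕP.<⇒≤ j<n) (λ l l<j → Q* l (ℕP.m<n⇒m<1+n l<j)))
                                  (Q* l (ℕP.≤-reflexive (cong suc toℕl≡j)) ∷ []))
  where
  l = F.fromℕ< j<n
  toℕl≡j = FP.toℕ-fromℕ< j<n
  stars≡ : starsBefore B (suc j) ≡ starsBefore B j ++ [ gsStar B l ]
  stars≡ = subst (λ i → starsBefore B (suc i) ≡ starsBefore B i ++ [ gsStar B l ]) toℕl≡j (starsBefore-suc B l)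

module GramSchmidt {n m} (B : Fin n → PVec m)
  (sorted : ∀ i j → i < j → degV (B i) ≤M degV (B j))
  (pilots-indep : LinIndep (λ i → pilot (B i)))
  (pilots-orth : ∀ i j → degV (B i) ≢ degV (B j) → dotℤ (pilot (B i)) (pilot (B j)) ≡ 0ℤ) where

  P : Fin n → Fin m → ℚ
  P l c = ι (pilot (B l) c)

  linComb : (Fin n → ℚ) → Fin m → ℚ
  linComb μ c = sum (λ l → μ l ℚ.* P l c)

  SupportedBelow : ℕ → (Fin n → ℚ) → Set
  SupportedBelow j μ = ∀ l → j ℕ.≤ F.toℕ l → μ l ≡ 0ℚ

  InSpanBelow : ℕ → (Fin m → ℚ) → Set
  InSpanBelow j w = Σ (Fin n → ℚ) λ μ → SupportedBelow j μ × (∀ c → w c ≡ linComb μ c)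

  linComb-+ : ∀ μ ν c → linComb (λ l → μ l ℚ.+ ν l) c ≡ linComb μ c ℚ.+ linComb ν c
  linComb-+ μ ν c = trans (sum-cong-≗ (λ l → ℚP.*-distribʳ-+ (P l c) (μ l) (ν l)))
                          (∑-distrib-+ (λ l → μ l ℚ.* P l c) (λ l → ν l ℚ.* P l c))

  linComb-* : ∀ r μ c → linComb (λ l → r ℚ.* μ l) c ≡ r ℚ.* linComb μ c
  linComb-* r μ c = trans (sum-cong-≗ (λ l → ℚP.*-assoc r (μ l) (P l c)))
                          (sym (*-distribˡ-sum r (λ l → μ l ℚ.* P l c)))

  linComb-neg : ∀ μ c → linComb (λ l → ℚ.- μ l) c ≡ ℚ.- linComb μ c
  linComb-neg μ c = trans (sum-cong-≗ (λ l → sym (ℚP.neg-distribˡ-* (μ l) (P l c))))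
                          (sum-neg (λ l → μ l ℚ.* P l c))

  inSpanBelow-0 : ∀ {j} → InSpanBelow j (λ _ → 0ℚ)
  inSpanBelow-0 = (λ _ → 0ℚ) , (λ _ _ → refl) , (λ c → sym (sum-zero _ (λ l → ℚP.*-zeroˡ (P l c))))

  inSpanBelow-+ : ∀ {j u w} → InSpanBelow j u → InSpanBelow j w → InSpanBelow j (λ c → u c ℚ.+ w c)
  inSpanBelow-+ (μ , μ-supp , u≡μ) (ν , ν-supp , w≡ν) =
    (λ l → μ l ℚ.+ ν l) ,
    (λ l j≤l → cong₂ ℚ._+_ (μ-supp l j≤l) (ν-supp l j≤l)) ,
    (λ c → trans (cong₂ ℚ._+_ (u≡μ c) (w≡ν c)) (sym (linComb-+ μ ν c)))

  P-indep : ∀ μ → (∀ c → linComb μ c ≡ 0ℚ) → ∀ l → μ l ≡ 0ℚ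
  P-indep = LinIndep⇒LinIndepℚ (λ i → pilot (B i)) pilots-indep

  degV-just : ∀ k → Σ ℕ λ d → degV (B k) ≡ just d
  degV-just k with degV (B k) in eq
  ... | just d  = d , refl
  ... | nothing = ⊥-elim (ℚP.1≢0 (trans (sym (δ-diag k)) (P-indep (δ k) linComb-δ≡0 k)))
    where
    linComb-δ≡0 : ∀ c → linComb (δ k) c ≡ 0ℚ
    linComb-δ≡0 c = trans (sum-δ* k (λ l → P l c)) (cong ι (pilot≡0 (B k) eq c))

  dg : Fin n → ℕ
  dg k = proj₁ (degV-just k)

  degV≡dg : ∀ k → degV (B k) ≡ just (dg k)
  degV≡dg k = proj₂ (degV-just k)

  dg≡ : ∀ {k d} → degV (B k) ≡ just d → dg k ≡ d
  dg≡ {k} degVk≡d = just-injective (trans (sym (degV≡dg k)) degVk≡d)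

  dg-mono : ∀ {l k} → F.toℕ l ℕ.≤ F.toℕ k → dg l ℕ.≤ dg k
  dg-mono {l} {k} l≤k with ℕP.m≤n⇒m<n∨m≡n l≤k
  ... | inj₁ l<k = subst₂ _≤M_ (degV≡dg l) (degV≡dg k) (sorted l k l<k)
  ... | inj₂ l≡k = ℕP.≤-reflexive (cong dg (FP.toℕ-injective l≡k))

  topTerm-B : ∀ k → TopTermVec (toR (B k)) (dg k) (P k)
  topTerm-B k c = subst (TopTerm (toR (B k) c) (dg k)) (cong ι (sym (pilot≡coeff (B k) (degV≡dg k) c)))
    (topTerm-fromPoly (B k c) (degV≡just⇒degP≤ (B k) (degV≡dg k) c))

  P-orth : ∀ {j l} → dg l ≢ dg j → sum (λ c → P j c ℚ.* P l c) ≡ 0ℚ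
  P-orth {j} {l} dl≢dj = begin
    sum (λ c → P j c ℚ.* P l c)                      ≡⟨ sum-cong-≗ (λ c → sym (ι-* (pilot (B j) c) (pilot (B l) c))) ⟩
    sum (λ c → ι (pilot (B j) c ℤ.* pilot (B l) c))  ≡⟨ sym (ι-sumℤ (λ c → pilot (B j) c ℤ.* pilot (B l) c)) ⟩
    ι (dotℤ (pilot (B j)) (pilot (B l)))             ≡⟨ cong ι (pilots-orth j l degVj≢degVl) ⟩
    0ℚ                                               ∎
    where
    open ≡-Reasoning
    degVj≢degVl : degV (B j) ≢ degV (B l)
    degVj≢degVl e = dl≢dj (sym (just-injective (trans (sym (degV≡dg j)) (trans e (degV≡dg l)))))

  linComb-orth : ∀ {i j} μ → SupportedBelow i μ → (∀ l → F.toℕ l ℕ.< i → sum (λ c → P j c ℚ.* P l c) ≡ 0ℚ) →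
    sum (λ c → P j c ℚ.* linComb μ c) ≡ 0ℚ
  linComb-orth {i} {j} μ μ-supp orth = begin
    sum (λ c → P j c ℚ.* sum (λ l → μ l ℚ.* P l c))    ≡⟨ sum-cong-≗ (λ c → *-distribˡ-sum (P j c) (λ l → μ l ℚ.* P l c)) ⟩
    sum (λ c → sum (λ l → P j c ℚ.* (μ l ℚ.* P l c)))  ≡⟨ ∑-comm (λ c l → P j c ℚ.* (μ l ℚ.* P l c)) ⟩
    sum (λ l → sum (λ c → P j c ℚ.* (μ l ℚ.* P l c)))  ≡⟨ sum-cong-≗ pull-out-μ ⟩
    sum (λ l → μ l ℚ.* sum (λ c → P j c ℚ.* P l c))    ≡⟨ sum-zero _ term≡0 ⟩
    0ℚ                                                 ∎
    where
    open ≡-Reasoning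
    open +-*-Solver
    pull-out-μ : ∀ l → sum (λ c → P j c ℚ.* (μ l ℚ.* P l c)) ≡ μ l ℚ.* sum (λ c → P j c ℚ.* P l c)
    pull-out-μ l = trans (sum-cong-≗ (λ c → solve 3 (λ x y z → x :* (y :* z) := y :* (x :* z)) refl (P j c) (μ l) (P l c)))
                         (sym (*-distribˡ-sum (μ l) (λ c → P j c ℚ.* P l c)))
    term≡0 : ∀ l → μ l ℚ.* sum (λ c → P j c ℚ.* P l c) ≡ 0ℚ
    term≡0 l with F.toℕ l ℕ.<? i
    ... | yes l<i = trans (cong (μ l ℚ.*_) (orth l l<i)) (ℚP.*-zeroʳ (μ l))
    ... | no  l≮i = trans (cong (ℚ._* S) (μ-supp l (ℕP.≮⇒≥ l≮i))) (ℚP.*-zeroˡ S)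
      where S = sum (λ c → P j c ℚ.* P l c)

  -- lead is the L_k of the header.
  record StarTop (k : Fin n) : Set where
    field
      coef           : Fin n → ℚ
      coef-k         : coef k ≡ 1ℚ
      coef-supported : SupportedBelow (suc (F.toℕ k)) coef
      top            : TopTermVec (gsStar B k) (dg k) (linComb coef)

    lead : Fin m → ℚ
    lead = linComb coef

    lead·lead≢0 : sum (λ c → lead c ℚ.* lead c) ≢ 0ℚ
    lead·lead≢0 sq≡0 = ℚP.1≢0 (trans (sym coef-k) (P-indep coef (sum-squares≡0⇒≡0 lead sq≡0) k))

    lead-orth : ∀ {j} → dg k ℕ.< dg j → sum (λ c → P j c ℚ.* lead c) ≡ 0ℚ
    lead-orth dk<dj = linComb-orth coef coef-supported (λ l l≤k →
      P-orth (ℕP.<⇒≢ (ℕP.≤-<-trans (dg-mono (ℕP.≤-pred l≤k)) dk<dj)))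

  starTop-pilot-minus-span : ∀ k w → InSpanBelow (F.toℕ k) w →
    TopTermVec (gsStar B k) (dg k) (λ c → P k c ℚ.+ ℚ.- w c) → StarTop k
  starTop-pilot-minus-span k w (ν , ν-supp , w≡ν) tw = record
    { coef           = coef
    ; coef-k         = trans (cong₂ (λ a b → a ℚ.+ ℚ.- b) (δ-diag k) (ν-supp k ℕP.≤-refl)) (ℚP.+-identityʳ 1ℚ)
    ; coef-supported = λ l k<l → trans (cong₂ (λ a b → a ℚ.+ ℚ.- b) (δ-off (λ k≡l → ℕP.<-irrefl (cong F.toℕ k≡l) k<l))
                                                                     (ν-supp l (ℕP.<⇒≤ k<l)))
                                       (ℚP.+-identityʳ 0ℚ)
    ; top            = λ c → subst (TopTerm (gsStar B k c) (dg k)) (top≡linComb c) (tw c)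
    }
    where
    coef : Fin n → ℚ
    coef l = δ k l ℚ.+ ℚ.- ν l
    top≡linComb : ∀ c → P k c ℚ.+ ℚ.- w c ≡ linComb coef c
    top≡linComb c = sym (begin
      linComb coef c                                  ≡⟨ linComb-+ (δ k) (λ l → ℚ.- ν l) c ⟩
      linComb (δ k) c ℚ.+ linComb (λ l → ℚ.- ν l) c   ≡⟨ cong₂ ℚ._+_ (sum-δ* k (λ l → P l c)) (linComb-neg ν c) ⟩
      P k c ℚ.+ ℚ.- linComb ν c                       ≡⟨ cong (λ x → P k c ℚ.+ ℚ.- x) (sym (w≡ν c)) ⟩
      P k c ℚ.+ ℚ.- w c                               ∎)
      where open ≡-Reasoning

  ProjectionTop : Fin n → RVec m → Set
  ProjectionTop k g = Σ (Fin m → ℚ) λ w →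
    InSpanBelow (F.toℕ k) w × TopTermVec (λ c → gsCoef (toR (B k)) g *R g c) (dg k) w

  projectionTop : ∀ {k l} → l < k → StarTop l → ProjectionTop k (gsStar B l)
  projectionTop {k} {l} l<k s = (λ c → r ℚ.* lead c) , span , top-term
    where
    open StarTop s
    r = sum (λ c → P k c ℚ.* lead c) ÷ sum (λ c → lead c ℚ.* lead c) [ lead·lead≢0 ]
    dk∸dl+dl≡dk : dg k ℕ.∸ dg l ℕ.+ dg l ≡ dg k
    dk∸dl+dl≡dk = ℕP.m∸n+n≡m (dg-mono (ℕP.<⇒≤ l<k))
    ρ-top : TopTerm (gsCoef (toR (B k)) (gsStar B l)) (dg k ℕ.∸ dg l) r
    ρ-top = topTerm-gsCoef (subst (λ D → TopTermVec (toR (B k)) D (P k)) (sym dk∸dl+dl≡dk) (topTerm-B k)) top lead·lead≢0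
    top-term : TopTermVec (λ c → gsCoef (toR (B k)) (gsStar B l) *R gsStar B l c) (dg k) (λ c → r ℚ.* lead c)
    top-term c = subst (λ D → TopTerm _ D (r ℚ.* lead c)) dk∸dl+dl≡dk (topTerm-*R ρ-top (top c))
    span : InSpanBelow (F.toℕ k) (λ c → r ℚ.* lead c)
    span = (λ l′ → r ℚ.* coef l′) ,
           (λ l′ k≤l′ → trans (cong (r ℚ.*_) (coef-supported l′ (ℕP.≤-trans l<k k≤l′))) (ℚP.*-zeroʳ r)) ,
           (λ c → sym (linComb-* r coef c))

  starTop : ∀ k → StarTop k
  starTop = WF.All.wfRec FI.<-wellFounded 0ℓ StarTop step
    where
    step : ∀ k → (∀ {l} → l < k → StarTop l) → StarTop k
    step k IH =
      let w , w∈span , tw = topTerm-reduce (InSpanBelow (F.toℕ k)) inSpanBelow-0 inSpanBelow-+ (toR (B k)) (topTerm-B k)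
                              (All-starsBefore B (ProjectionTop k) (F.toℕ k) (ℕP.<⇒≤ (FP.toℕ<n k))
                                               (λ l l<k → projectionTop l<k (IH l<k)))
      in starTop-pilot-minus-span k w w∈span tw

  gsρ-degR< : ∀ {i j} → dg i ℕ.< dg j → degR (gsρ B j i) <M (+ dg j - + dg i)
  gsρ-degR< {i} {j} dgi<dgj = gsCoef-degR< dgi<dgj (topTerm-B j) top lead·lead≢0 (lead-orth dgi<dgj)
    where open StarTop (starTop i)

lemma3p18 : ∀ {n m} (B : Fin n → PVec m) →
    ParametricBasis B →
    (∀ i j → i < j → degV (B i) ≤M degV (B j)) →
    LinIndep (λ i → pilot (B i)) →
    (∀ i j → degV (B i) ≢ degV (B j) → dotℤ (pilot (B i)) (pilot (B j)) ≡ 0ℤ) →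
    ∀ i j (di dj : ℕ) → i < j → degV (B i) ≡ just di → degV (B j) ≡ just dj →
    di Data.Nat.< dj →
    degR (gsρ B j i) <M (+ dj - + di)
lemma3p18 B _ sorted indep orth i j di dj _ degVi≡di degVj≡dj di<dj =
  subst₂ (λ d e → degR (gsρ B j i) <M (+ e - + d)) (dg≡ degVi≡di) (dg≡ degVj≡dj)
    (gsρ-degR< (subst₂ ℕ._<_ (sym (dg≡ degVi≡di)) (sym (dg≡ degVj≡dj)) di<dj))
  where open GramSchmidt B sorted indep orth
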